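{- For every $\varepsilon>0$ there exist a graph $G$ and an induced subgraph $H$ of $G$ such that $$\frac{\operatorname{cdim}(G)}{\operatorname{cdim}(H)}\leq \varepsilon.$$
   Context: All graphs are nonempty, finite, simple and undirected. For distinct vertices $v,w$ of a graph $G$, $\kappa(v,w)$ denotes the maximum number of internally vertex-disjoint $v$–$w$ paths in $G$; by convention $\kappa(v,v)=\infty$. For an ordered vertex set $W=\{w_1,\ldots,w_k\}\subseteq V(G)$, the connectivity representation of $v$ is $r(v,W)=[\kappa(v,w_1),\ldots,\kappa(v,w_k)]$. $W$ is resolving for $G$ if $r(v_1,W)=r(v_2,W)$ implies $v_1=v_2$ for all $v_1,v_2\in V(G)$. The connectivity dimension $\operatorname{cdim}(G)$ is the minimum cardinality of a resolving set of $G$. -}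

module Defs where

open import Data.Nat using (ℕ; suc)
open import Data.Bool using (Bool; T)
open import Data.Fin using (Fin)
open import Data.Fin.Subset using (Subset; _∈_; ∣_∣)
open import Data.List using (List; []; _∷_; _++_; [_])
open import Data.List.Relation.Unary.Linked using (Linked)
open import Data.List.Relation.Unary.Unique.Propositional using (Unique)
open import Data.List.Relation.Binary.Disjoint.Propositional using (Disjoint)
open import Data.Product using (Σ; _×_; ∃)
open import Relation.Binary.PropositionalEquality using (_≡_; _≢_)
open import Relation.Nullary using (¬_)

record Graph (n : ℕ) : Set where
  field
    adj    : Fin n → Fin n → Bool
    sym    : ∀ i j → adj i j ≡ adj j i
    irrefl : ∀ i → adj i i ≡ Data.Bool.false
open Graph public

Adj : ∀ {n} → Graph n → Fin n → Fin n → Set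
Adj G i j = T (adj G i j)

-- A v–w path is given by its list xs of internal vertices: the vertex
-- sequence v ∷ xs ++ [ w ] must have consecutive vertices adjacent and
-- all vertices distinct.
IsPath : ∀ {n} → Graph n → Fin n → Fin n → List (Fin n) → Set
IsPath G v w xs = Linked (Adj G) (v ∷ xs ++ [ w ]) × Unique (v ∷ xs ++ [ w ])

HasDisjointPaths : ∀ {n} → Graph n → Fin n → Fin n → ℕ → Set
HasDisjointPaths {n} G v w k =
  Σ (Fin k → List (Fin n)) λ P →
    (∀ i → IsPath G v w (P i)) ×
    (∀ i j → P i ≡ P j → i ≡ j) ×
    (∀ i j → i ≢ j → Disjoint (P i) (P j))

data ℕ∞ : Set where
  fin : ℕ → ℕ∞
  ∞   : ℕ∞

data IsKappa {n} (G : Graph n) : Fin n → Fin n → ℕ∞ → Set where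
  kappa-refl : ∀ {v} → IsKappa G v v ∞
  kappa-max  : ∀ {v w k} → v ≢ w → HasDisjointPaths G v w k →
               ¬ HasDisjointPaths G v w (suc k) → IsKappa G v w (fin k)

SameRep : ∀ {n} → Graph n → Subset n → Fin n → Fin n → Set
SameRep G W v₁ v₂ = ∀ w → w ∈ W → ∀ x →
  (IsKappa G v₁ w x → IsKappa G v₂ w x) × (IsKappa G v₂ w x → IsKappa G v₁ w x)

Resolving : ∀ {n} → Graph n → Subset n → Set
Resolving G W = ∀ v₁ v₂ → SameRep G W v₁ v₂ → v₁ ≡ v₂

IsCdim : ∀ {n} → Graph n → ℕ → Set
IsCdim {n} G d =
  (Σ (Subset n) λ W → Resolving G W × ∣ W ∣ ≡ d) ×
  (∀ W → Resolving G W → d Data.Nat.≤ ∣ W ∣)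

IsInducedSubgraph : ∀ {m n} → Graph m → Graph n → Set
IsInducedSubgraph {m} {n} H G =
  Σ (Fin m → Fin n) λ f →
    (∀ i j → f i ≡ f j → i ≡ j) × (∀ i j → adj H i j ≡ adj G (f i) (f j))

{-# OPTIONS --safe #-}

-- Let G be the graph on {0, …, 2c} with s ~ t iff s ≠ t and s + t ≤ 2c + 1.  Its top block
-- {c + 1, …, 2c} is independent, so G contains the edgeless graph H on c vertices, in which
-- any two vertices are twins.  Swapping two twins is an automorphism, so a resolving set meets
-- every pair of twins: this gives cdim H = c − 1, and cdim G ≥ 2 from the disjoint twin pairs
-- {0, 1} and {c, c + 1}.  As 0 is universal, κ(v, 0) is the degree of v, and the degrees of
-- 1, …, 2c are distinct except for those of c and c + 1, so {0, c + 1} resolves G.  Thus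
-- cdim G / cdim H = 2 / (c − 1), which is at most ε once c is large.

module Submission where

open import Defs renaming (sym to adj-sym)
open import Data.Bool using (true; false; T)
open import Data.Empty using (⊥; ⊥-elim)
open import Data.Fin using (Fin; zero; suc; toℕ; _↑ʳ_; punchIn; punchOut; inject≤; inject₁; fromℕ<)
open import Data.Fin.Properties
  using (_≟_; any?; toℕ-injective; toℕ<n; toℕ≤pred[n]; toℕ-fromℕ<; toℕ-inject₁; toℕ-inject≤;
         inject≤-injective; injective⇒≤; punchIn-injective; punchInᵢ≢i; punchIn-punchOut;
         toℕ-↑ʳ; ↑ʳ-injective)
open import Data.Fin.Permutation
  using (Permutation′; _⟨$⟩ʳ_; _⟨$⟩ˡ_; inverseˡ; inverseʳ; flip; transpose)
open import Data.Fin.Subset using (Subset; _∈_; _∉_; ∣_∣; ⁅_⁆; ∁; _⊆_; ⊤; _-_)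
open import Data.Fin.Subset.Properties
  using (_∈?_; x∈⁅x⁆; x∈⁅y⁆⇒x≡y; x∉⁅y⁆⇒x≢y; ∣⁅x⁆∣≡1; ∣∁p∣≡n∸∣p∣; ∣⊤∣≡n; p⊆q⇒∣p∣≤∣q∣;
         x∉∁p⇒x∈p; x∈∁p⇒x∉p; x∈p⇒∣p-x∣<∣p∣; x∈p∧x≢y⇒x∈p-y)
import Data.Vec.Base as Vec
open import Data.List using (List; []; _∷_; _++_; [_]; map)
open import Data.List.Properties using (map-++; map-injective)
open import Data.List.Membership.Propositional using () renaming (_∈_ to _∈ₗ_)
open import Data.List.Membership.Propositional.Properties using (∈-map⁻; ∈-++⁺ʳ)
open import Data.List.Relation.Binary.Disjoint.Propositional using (Disjoint)
open import Data.List.Relation.Unary.All using ([]; _∷_) renaming (lookup to All-lookup)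
open import Data.List.Relation.Unary.AllPairs using ([]; _∷_)
open import Data.List.Relation.Unary.Any using (here)
open import Data.List.Relation.Unary.Linked
  using (Linked; [-]; _∷_) renaming (head to Linked-head; map to Linked-map)
open import Data.List.Relation.Unary.Linked.Properties using () renaming (map⁺ to Linked-map⁺)
open import Data.List.Relation.Unary.Unique.Propositional using (Unique)
open import Data.List.Relation.Unary.Unique.Propositional.Properties
  using () renaming (map⁺ to Unique-map⁺)
import Data.Nat as ℕ
open import Data.Nat using (ℕ; zero; suc; _+_; _∸_; _≤_; _<_; _≤?_; z≤n; s≤s; s≤s⁻¹; z<s)
open import Data.Nat.Properties
  using (+-comm; +-suc; *-identityʳ; +-cancelˡ-≡; +-cancelˡ-≤; +-cancelʳ-≤; +-cancelʳ-<;
         +-mono-≤; +-monoˡ-≤; +-monoʳ-≤; +-mono-<; ≤-refl; ≤-reflexive; ≤-trans; ≤-antisym;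
         <⇒≤; <⇒≱; ≮⇒≥; ≤∧≢⇒<; <-cmp; n≤1+n; n<1+n; n≮n; 1+n≢n; m≤m+n; m<m+n;
         m≤m*n; m≤n*m; m∸n+n≡m; module ≤-Reasoning)
open import Data.Integer as ℤ using (+_; +[1+_]; +0; -[1+_])
import Data.Integer.Properties as ℤ
open import Data.Rational using (ℚ; 0ℚ; _/_; _*_; mkℚ; toℚᵘ; *<*)
  renaming (_<_ to _<ℚ_; _≤_ to _≤ℚ_)
open import Data.Rational.Properties using (toℚᵘ-cancel-≤; toℚᵘ-fromℚᵘ; toℚᵘ-homo-*)
open import Data.Rational.Unnormalised as ℚᵘ using (mkℚᵘ; *≤*)
import Data.Rational.Unnormalised.Properties as ℚᵘ
open import Data.Product using (Σ; _×_; _,_; proj₁; proj₂; swap)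
open import Data.Sum using (_⊎_; inj₁; inj₂)
open import Data.Unit using (tt)
open import Function using (_∘_; _⇔_; mk⇔; Injection)
open import Function.Properties.Inverse using (↔⇒↣)
open import Function.Definitions using (Injective)
open import Level using (0ℓ)
open import Relation.Binary using (Rel; Decidable; Symmetric; Irreflexive; tri<; tri≈; tri>)
open import Relation.Binary.PropositionalEquality
  using (_≡_; _≢_; refl; sym; trans; cong; cong₂; subst; subst₂; module ≡-Reasoning)
open import Relation.Nullary using (¬_; yes; no; does; contradiction)
open import Relation.Nullary.Decidable
  using (dec-true; dec-false; does-⇔; ¬?; _×-dec_; decidable-stable)
open import Relation.Unary using (Pred; _≐_)

private
  variable
    n n′ j k d : ℕ
    v w a u u′ x y : Fin n

Adj-irrefl : (G : Graph n) → Adj G u u′ → u ≢ u′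
Adj-irrefl {u = u} G uu refl rewrite irrefl G u = uu

HasDisjointPaths-≤ : (G : Graph n) → j ≤ k → HasDisjointPaths G v w k → HasDisjointPaths G v w j
HasDisjointPaths-≤ G j≤k (P , paths , distinct , disjoint) =
  (λ i → P (inject≤ i j≤k)) , (λ i → paths _) ,
  (λ i i′ eq → inject≤-injective j≤k j≤k i i′ (distinct _ _ eq)) ,
  (λ i i′ i≢i′ → disjoint _ _ (i≢i′ ∘ inject≤-injective j≤k j≤k i i′))

¬HasDisjointPaths⇒≤ : (G : Graph n) → ¬ HasDisjointPaths G v w (suc k) →
                     HasDisjointPaths G v w j → j ≤ k
¬HasDisjointPaths⇒≤ G maximal paths = ≮⇒≥ (λ k<j → maximal (HasDisjointPaths-≤ G k<j paths))

IsKappa-functional : ∀ {G : Graph n} {κ κ′} → IsKappa G v w κ → IsKappa G v w κ′ → κ ≡ κ′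
IsKappa-functional kappa-refl kappa-refl = refl
IsKappa-functional kappa-refl (kappa-max v≢v _ _) = contradiction refl v≢v
IsKappa-functional (kappa-max v≢v _ _) kappa-refl = contradiction refl v≢v
IsKappa-functional {G = G} (kappa-max _ p ¬p) (kappa-max _ q ¬q) =
  cong fin (≤-antisym (¬HasDisjointPaths⇒≤ G ¬q p) (¬HasDisjointPaths⇒≤ G ¬p q))

fin-injective : ∀ {x y} → fin x ≡ fin y → x ≡ y
fin-injective refl = refl

IsKappa-∞ : ∀ {G : Graph n} → IsKappa G v w ∞ → v ≡ w
IsKappa-∞ kappa-refl = refl

module _ {G : Graph n} {G′ : Graph n′} {f : Fin n → Fin n′}
         (f-injective : Injective _≡_ _≡_ f)
         (f-homomorphic : ∀ {x y} → Adj G x y → Adj G′ (f x) (f y)) where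

  IsPath-map : ∀ {xs} → IsPath G v w xs → IsPath G′ (f v) (f w) (map f xs)
  IsPath-map {v = v} {w} {xs} (linked , unique) =
    subst (Linked (Adj G′)) image (Linked-map⁺ (Linked-map f-homomorphic linked)) ,
    subst Unique image (Unique-map⁺ f-injective unique)
    where
    image : f v ∷ map f (xs ++ [ w ]) ≡ f v ∷ map f xs ++ [ f w ]
    image = cong (f v ∷_) (map-++ f xs [ w ])

  Disjoint-map : ∀ {xs ys} → Disjoint xs ys → Disjoint (map f xs) (map f ys)
  Disjoint-map disjoint (x∈fxs , x∈fys) with ∈-map⁻ f x∈fxs | ∈-map⁻ f x∈fys
  ... | _ , y∈xs , refl | _ , y′∈ys , fy≡fy′ =
    disjoint (y∈xs , subst (_∈ₗ _) (f-injective (sym fy≡fy′)) y′∈ys)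

  HasDisjointPaths-map : HasDisjointPaths G v w k → HasDisjointPaths G′ (f v) (f w) k
  HasDisjointPaths-map (P , paths , distinct , disjoint) =
    (λ i → map f (P i)) , (λ i → IsPath-map (paths i)) ,
    (λ i j eq → distinct i j (map-injective f-injective eq)) ,
    (λ i j i≢j → Disjoint-map (disjoint i j i≢j))

record IsAutomorphism (G : Graph n) (σ : Permutation′ n) : Set where
  field adj-preserved : ∀ x y → adj G (σ ⟨$⟩ʳ x) (σ ⟨$⟩ʳ y) ≡ adj G x y
open IsAutomorphism

flip-automorphism : ∀ {G : Graph n} {σ} → IsAutomorphism G σ → IsAutomorphism G (flip σ)
flip-automorphism {G = G} {σ} automorphism .adj-preserved x y = begin
  adj G (σ ⟨$⟩ˡ x) (σ ⟨$⟩ˡ y)                    ≡⟨ adj-preserved automorphism _ _ ⟨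
  adj G (σ ⟨$⟩ʳ (σ ⟨$⟩ˡ x)) (σ ⟨$⟩ʳ (σ ⟨$⟩ˡ y))  ≡⟨ cong₂ (adj G) (inverseʳ σ) (inverseʳ σ) ⟩
  adj G x y                                      ∎
  where open ≡-Reasoning

HasDisjointPaths-automorphism : ∀ {G : Graph n} {σ} → IsAutomorphism G σ →
  HasDisjointPaths G v w k → HasDisjointPaths G (σ ⟨$⟩ʳ v) (σ ⟨$⟩ʳ w) k
HasDisjointPaths-automorphism {G = G} {σ} automorphism =
  HasDisjointPaths-map {G = G} {G′ = G} (Injection.injective (↔⇒↣ σ))
    (λ {x} {y} → subst T (sym (adj-preserved automorphism x y)))

IsKappa-automorphism : ∀ {G : Graph n} {σ κ} → IsAutomorphism G σ →
  IsKappa G v w κ → IsKappa G (σ ⟨$⟩ʳ v) (σ ⟨$⟩ʳ w) κ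
IsKappa-automorphism _ kappa-refl = kappa-refl
IsKappa-automorphism {G = G} {σ} automorphism (kappa-max v≢w paths maximal) =
  kappa-max (v≢w ∘ Injection.injective (↔⇒↣ σ)) (HasDisjointPaths-automorphism automorphism paths)
    (maximal ∘ subst₂ (λ v′ w′ → HasDisjointPaths G v′ w′ _) (inverseˡ σ) (inverseˡ σ)
             ∘ HasDisjointPaths-automorphism (flip-automorphism automorphism))

automorphism-SameRep : ∀ {G : Graph n} {σ W} → IsAutomorphism G σ →
  (∀ {w} → w ∈ W → σ ⟨$⟩ʳ w ≡ w) → SameRep G W v (σ ⟨$⟩ʳ v)
automorphism-SameRep {v = v} {G = G} {σ} automorphism fixes w w∈W κ =
  (λ κ-v → subst (λ w′ → IsKappa G (σ ⟨$⟩ʳ v) w′ κ) (fixes w∈W)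
             (IsKappa-automorphism automorphism κ-v)) ,
  (λ κ-σv → subst₂ (λ v′ w′ → IsKappa G v′ w′ κ) (inverseˡ σ) σ⁻¹-fixes-w
              (IsKappa-automorphism (flip-automorphism automorphism) κ-σv))
  where
  σ⁻¹-fixes-w : σ ⟨$⟩ˡ w ≡ w
  σ⁻¹-fixes-w = trans (cong (σ ⟨$⟩ˡ_) (sym (fixes w∈W))) (inverseˡ σ)

Twins : Graph n → Fin n → Fin n → Set
Twins G x y = ∀ z → z ≢ x → z ≢ y → adj G x z ≡ adj G y z

data Position (x y : Fin n) : Fin n → Set where
  at-x      : Position x y x
  at-y      : Position x y y
  elsewhere : ∀ {z} → z ≢ x → z ≢ y → Position x y z

position : ∀ (x y z : Fin n) → Position x y z
position x y z with z ≟ x | z ≟ y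
... | yes refl | _        = at-x
... | no _     | yes refl = at-y
... | no z≢x   | no z≢y   = elsewhere z≢x z≢y

transpose-matchˡ : ∀ (x y : Fin n) → transpose x y ⟨$⟩ʳ x ≡ y
transpose-matchˡ x y rewrite dec-true (x ≟ x) refl = refl

transpose-matchʳ : ∀ (x y : Fin n) → transpose x y ⟨$⟩ʳ y ≡ x
transpose-matchʳ x y with y ≟ x
... | yes y≡x = y≡x
... | no _ rewrite dec-true (y ≟ y) refl = refl

transpose-mismatch : ∀ {x y z : Fin n} → z ≢ x → z ≢ y → transpose x y ⟨$⟩ʳ z ≡ z
transpose-mismatch {x = x} {y} {z} z≢x z≢y
  rewrite dec-false (z ≟ x) z≢x | dec-false (z ≟ y) z≢y = refl

twins-automorphism : ∀ {G : Graph n} → Twins G x y → IsAutomorphism G (transpose x y)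
twins-automorphism {x = x} {y} {G} twins .adj-preserved a b with position x y a | position x y b
... | at-x | at-x rewrite transpose-matchˡ x y = trans (irrefl G y) (sym (irrefl G x))
... | at-x | at-y rewrite transpose-matchˡ x y | transpose-matchʳ x y = adj-sym G y x
... | at-y | at-x rewrite transpose-matchˡ x y | transpose-matchʳ x y = adj-sym G x y
... | at-y | at-y rewrite transpose-matchʳ x y = trans (irrefl G x) (sym (irrefl G y))
... | at-x | elsewhere b≢x b≢y rewrite transpose-matchˡ x y | transpose-mismatch b≢x b≢y =
  sym (twins b b≢x b≢y)
... | at-y | elsewhere b≢x b≢y rewrite transpose-matchʳ x y | transpose-mismatch b≢x b≢y =
  twins b b≢x b≢y
... | elsewhere a≢x a≢y | at-x rewrite transpose-matchˡ x y | transpose-mismatch a≢x a≢y =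
  trans (adj-sym G a y) (trans (sym (twins a a≢x a≢y)) (adj-sym G x a))
... | elsewhere a≢x a≢y | at-y rewrite transpose-matchʳ x y | transpose-mismatch a≢x a≢y =
  trans (adj-sym G a x) (trans (twins a a≢x a≢y) (adj-sym G y a))
... | elsewhere a≢x a≢y | elsewhere b≢x b≢y
  rewrite transpose-mismatch a≢x a≢y | transpose-mismatch b≢x b≢y = refl

twins-meet-resolving : ∀ {G : Graph n} {W} → x ≢ y → Twins G x y → Resolving G W → x ∈ W ⊎ y ∈ W
twins-meet-resolving {x = x} {y} {G} {W} x≢y twins resolving with x ∈? W | y ∈? W
... | yes x∈W | _       = inj₁ x∈W
... | no _    | yes y∈W = inj₂ y∈W
... | no x∉W  | no y∉W  = contradiction (resolving x y same) x≢y
  where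
  transpose-fixes-W : ∀ {w} → w ∈ W → transpose x y ⟨$⟩ʳ w ≡ w
  transpose-fixes-W w∈W = transpose-mismatch (λ { refl → x∉W w∈W }) (λ { refl → y∉W w∈W })
  same : SameRep G W x y
  same = subst (SameRep G W x) (transpose-matchˡ x y)
           (automorphism-SameRep (twins-automorphism twins) transpose-fixes-W)

-- P has exactly d elements.  Stated with maps both ways instead of Fin d ↔ Σ (Fin n) P, so
-- that P need not be proof-irrelevant.
record Enumeration (P : Pred (Fin n) 0ℓ) (d : ℕ) : Set where
  field
    element           : Fin d → Fin n
    element-injective : Injective _≡_ _≡_ element
    element-∈         : ∀ i → P (element i)
    index             : P u → Fin d
    element-index     : (p : P u) → element (index p) ≡ u

  index-injective : (p : P u) (p′ : P u′) → index p ≡ index p′ → u ≡ u′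
  index-injective p p′ eq =
    trans (sym (element-index p)) (trans (cong element eq) (element-index p′))

open Enumeration

Enumeration-resp-≐ : ∀ {P Q : Pred (Fin n) 0ℓ} → P ≐ Q → Enumeration P d → Enumeration Q d
Enumeration-resp-≐ (P⊆Q , Q⊆P) e = record
  { element = element e ; element-injective = element-injective e
  ; element-∈ = P⊆Q ∘ element-∈ e
  ; index = index e ∘ Q⊆P ; element-index = element-index e ∘ Q⊆P }

prefix-enumeration : d ≤ n → Enumeration (λ (u : Fin n) → toℕ u < d) d
prefix-enumeration d≤n = record
  { element           = λ i → inject≤ i d≤n
  ; element-injective = inject≤-injective d≤n d≤n _ _
  ; element-∈         = λ i → subst (_< _) (sym (toℕ-inject≤ i d≤n)) (toℕ<n i)
  ; index             = λ u<d → fromℕ< u<d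
  ; element-index     = λ u<d → toℕ-injective (trans (toℕ-inject≤ _ d≤n) (toℕ-fromℕ< u<d)) }

remove-enumeration : ∀ {P : Pred (Fin n) 0ℓ} → Enumeration P (suc d) → P a →
                     Enumeration (λ u → P u × u ≢ a) d
remove-enumeration {a = a} e pa = record
  { element           = element e ∘ punchIn (index e pa)
  ; element-injective = punchIn-injective _ _ _ ∘ element-injective e
  ; element-∈         = λ i → element-∈ e _ , missed i
  ; index             = λ (pu , u≢a) → punchOut (u≢a ∘ sym ∘ index-injective e pa pu)
  ; element-index     = λ (pu , _) →
      trans (cong (element e) (punchIn-punchOut _)) (element-index e pu) }
  where
  missed : ∀ i → element e (punchIn (index e pa) i) ≢ a
  missed i eq = punchInᵢ≢i _ i (element-injective e (trans eq (sym (element-index e pa))))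

Universal : Graph n → Fin n → Set
Universal G a = ∀ u → u ≢ a → Adj G u a

nextVertex : Fin n → List (Fin n) → Fin n
nextVertex w []      = w
nextVertex w (x ∷ _) = x

nextVertex-adj : (G : Graph n) {xs : List (Fin n)} → IsPath G v w xs → Adj G v (nextVertex w xs)
nextVertex-adj _ {[]}    (linked , _) = Linked-head linked
nextVertex-adj _ {_ ∷ _} (linked , _) = Linked-head linked

internal≢end : (G : Graph n) {xs : List (Fin n)} → IsPath G v w (x ∷ xs) → x ≢ w
internal≢end _ {xs} (_ , _ ∷ x∉rest ∷ _) = All-lookup x∉rest (∈-++⁺ʳ xs (here refl))

nextVertex-separates : (G : Graph n) {xs ys : List (Fin n)} → IsPath G v w xs → IsPath G v w ys →
                       xs ≢ ys → Disjoint xs ys → nextVertex w xs ≢ nextVertex w ys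
nextVertex-separates _ {[]}    {[]}    _ _ xs≢ys _ _        = xs≢ys refl
nextVertex-separates G {[]}    {_ ∷ _} _ q _     _ w≡y      = internal≢end G q (sym w≡y)
nextVertex-separates G {_ ∷ _} {[]}    p _ _     _ x≡w      = internal≢end G p x≡w
nextVertex-separates _ {_ ∷ _} {_ ∷ _} _ _ _     disjoint refl = disjoint (here refl , here refl)

HasDisjointPaths⇒≤-degree : (G : Graph n) → Enumeration (Adj G v) d →
                            HasDisjointPaths G v w k → k ≤ d
HasDisjointPaths⇒≤-degree G neighbours (P , paths , distinct , disjoint) =
  injective⇒≤ first-step-injective
  where
  first-step-injective : Injective _≡_ _≡_ (λ i → index neighbours (nextVertex-adj G (paths i)))
  first-step-injective {i} {j} eq with i ≟ j
  ... | yes i≡j = i≡j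
  ... | no i≢j  = contradiction (index-injective neighbours _ _ eq)
    (nextVertex-separates G (paths i) (paths j) (i≢j ∘ distinct i j) (disjoint i j i≢j))

module _ {G : Graph n} (universal : Universal G a) (v≢a : v ≢ a) where

  viaNeighbour : Fin n → List (Fin n)
  viaNeighbour u with u ≟ a
  ... | yes _ = []
  ... | no _  = [ u ]

  viaNeighbour-path : Adj G v u → IsPath G v a (viaNeighbour u)
  viaNeighbour-path {u} vu with u ≟ a
  ... | yes refl = (vu ∷ [-]) , ((v≢a ∷ []) ∷ [] ∷ [])
  ... | no u≢a   = (vu ∷ universal u u≢a ∷ [-]) ,
                   ((Adj-irrefl G vu ∷ v≢a ∷ []) ∷ (u≢a ∷ []) ∷ [] ∷ [])

  viaNeighbour-internal : x ∈ₗ viaNeighbour u → x ≡ u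
  viaNeighbour-internal {u = u} x∈ with u ≟ a
  viaNeighbour-internal (here x≡u) | no _ = x≡u

  viaNeighbour-injective : viaNeighbour u ≡ viaNeighbour u′ → u ≡ u′
  viaNeighbour-injective {u} {u′} eq with u ≟ a | u′ ≟ a
  viaNeighbour-injective refl | yes u≡a | yes u′≡a = trans u≡a (sym u′≡a)
  viaNeighbour-injective ()   | yes _   | no _
  viaNeighbour-injective ()   | no _    | yes _
  viaNeighbour-injective refl | no _    | no _    = refl

  universal⇒HasDisjointPaths : Enumeration (Adj G v) d → HasDisjointPaths G v a d
  universal⇒HasDisjointPaths neighbours =
    (viaNeighbour ∘ element neighbours) ,
    (λ i → viaNeighbour-path (element-∈ neighbours i)) ,
    (λ i j → element-injective neighbours ∘ viaNeighbour-injective) ,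
    (λ i j i≢j (x∈i , x∈j) → i≢j (element-injective neighbours
       (trans (sym (viaNeighbour-internal x∈i)) (viaNeighbour-internal x∈j))))

  IsKappa-universal : Enumeration (Adj G v) d → IsKappa G v a (fin d)
  IsKappa-universal neighbours =
    kappa-max v≢a (universal⇒HasDisjointPaths neighbours)
      (n≮n _ ∘ HasDisjointPaths⇒≤-degree G neighbours)

module FromRelation {R : Rel (Fin n) 0ℓ}
  (R? : Decidable R) (R-sym : Symmetric R) (R-irrefl : Irreflexive _≡_ R) where

  graph : Graph n
  graph = record
    { adj    = λ s t → does (R? s t)
    ; sym    = λ s t → does-⇔ (mk⇔ R-sym R-sym) (R? s t) (R? t s)
    ; irrefl = λ s → dec-false (R? s s) (R-irrefl refl) }

  Adj⇒R : Adj graph u u′ → R u u′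
  Adj⇒R {u} {u′} with R? u u′
  ... | yes r = λ _ → r
  ... | no _  = λ ()

  R⇒Adj : R u u′ → Adj graph u u′
  R⇒Adj {u} {u′} r = subst T (sym (dec-true (R? u u′) r)) tt

  ¬R⇒nonadjacent : ¬ R u u′ → adj graph u u′ ≡ false
  ¬R⇒nonadjacent {u} {u′} = dec-false (R? u u′)

  R-twins⇒Twins : (∀ z → z ≢ x → z ≢ y → R x z ⇔ R y z) → Twins graph x y
  R-twins⇒Twins {x} {y} R-twins z z≢x z≢y = does-⇔ (R-twins z z≢x z≢y) (R? x z) (R? y z)

SameRep-∈ : ∀ {G : Graph n} {W v₁ v₂} → SameRep G W v₁ v₂ → v₁ ∈ W → v₁ ≡ v₂
SameRep-∈ same v₁∈W = sym (IsKappa-∞ (proj₁ (same _ v₁∈W ∞) kappa-refl))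

Resolving-outside : ∀ {G : Graph n} {W} →
  (∀ {v₁ v₂} → v₁ ∉ W → v₂ ∉ W → SameRep G W v₁ v₂ → v₁ ≡ v₂) → Resolving G W
Resolving-outside {W = W} outside v₁ v₂ same with v₁ ∈? W | v₂ ∈? W
... | yes v₁∈W | _        = SameRep-∈ same v₁∈W
... | no _     | yes v₂∈W = IsKappa-∞ (proj₂ (same v₂ v₂∈W ∞) kappa-refl)
... | no v₁∉W  | no v₂∉W  = outside v₁∉W v₂∉W same

x∈p∧y∈p∧x≢y⇒2≤∣p∣ : ∀ {p : Subset n} → x ∈ p → y ∈ p → x ≢ y → 2 ≤ ∣ p ∣
x∈p∧y∈p∧x≢y⇒2≤∣p∣ {x = x} {y} {p} x∈p y∈p x≢y = begin
  2              ≤⟨ s≤s (≤-trans (s≤s z≤n) (x∈p⇒∣p-x∣<∣p∣ (x∈p∧x≢y⇒x∈p-y y∈p (x≢y ∘ sym)))) ⟩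
  suc ∣ p - x ∣  ≤⟨ x∈p⇒∣p-x∣<∣p∣ x∈p ⟩
  ∣ p ∣          ∎
  where open ≤-Reasoning

meets-all-pairs⇒n≤∣p∣ : ∀ {p : Subset (suc n)} → (∀ {x y} → x ≢ y → x ∈ p ⊎ y ∈ p) → n ≤ ∣ p ∣
meets-all-pairs⇒n≤∣p∣ {n} {p} meets with any? (λ u → ¬? (u ∈? p))
... | yes (u , u∉p) = begin
  n                 ≡⟨ cong (suc n ∸_) (∣⁅x⁆∣≡1 u) ⟨
  suc n ∸ ∣ ⁅ u ⁆ ∣  ≡⟨ ∣∁p∣≡n∸∣p∣ ⁅ u ⁆ ⟨
  ∣ ∁ ⁅ u ⁆ ∣        ≤⟨ p⊆q⇒∣p∣≤∣q∣ ∁⁅u⁆⊆p ⟩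
  ∣ p ∣             ∎
  where
  open ≤-Reasoning
  ∁⁅u⁆⊆p : ∁ ⁅ u ⁆ ⊆ p
  ∁⁅u⁆⊆p z∈∁⁅u⁆ with meets (x∉⁅y⁆⇒x≢y (x∈∁p⇒x∉p z∈∁⁅u⁆))
  ... | inj₁ z∈p = z∈p
  ... | inj₂ u∈p = contradiction u∈p u∉p
... | no ∄u∉p = begin
  n              ≤⟨ n≤1+n n ⟩
  suc n          ≡⟨ ∣⊤∣≡n (suc n) ⟨
  ∣ ⊤ {suc n} ∣  ≤⟨ p⊆q⇒∣p∣≤∣q∣ ⊤⊆p ⟩
  ∣ p ∣          ∎
  where
  open ≤-Reasoning
  ⊤⊆p : ⊤ ⊆ p
  ⊤⊆p {z} _ = decidable-stable (z ∈? p) (∄u∉p ∘ (z ,_))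

edgeless : ∀ n → Graph n
edgeless n = record { adj = λ _ _ → false ; sym = λ _ _ → refl ; irrefl = λ _ → refl }

IsCdim-edgeless : ∀ n → IsCdim (edgeless (suc n)) n
IsCdim-edgeless n =
  (∁ ⁅ zero ⁆ , Resolving-outside outside-is-zero , ∣∁⁅zero⁆∣≡n) ,
  (λ W resolving →
     meets-all-pairs⇒n≤∣p∣ (λ x≢y → twins-meet-resolving x≢y (λ _ _ _ → refl) resolving))
  where
  outside-is-zero : ∀ {v₁ v₂} → v₁ ∉ ∁ ⁅ zero ⁆ → v₂ ∉ ∁ ⁅ zero ⁆ →
                    SameRep (edgeless (suc n)) (∁ ⁅ zero ⁆) v₁ v₂ → v₁ ≡ v₂
  outside-is-zero v₁∉ v₂∉ _ =
    trans (x∈⁅y⁆⇒x≡y zero (x∉∁p⇒x∈p v₁∉)) (sym (x∈⁅y⁆⇒x≡y zero (x∉∁p⇒x∈p v₂∉)))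
  ∣∁⁅zero⁆∣≡n : ∣ ∁ ⁅ zero {n} ⁆ ∣ ≡ n
  ∣∁⁅zero⁆∣≡n = trans (∣∁p∣≡n∸∣p∣ ⁅ zero {n} ⁆) (cong (suc n ∸_) (∣⁅x⁆∣≡1 (zero {n})))

independent⇒induced-edgeless : ∀ {m} (G : Graph n) (f : Fin m → Fin n) → Injective _≡_ _≡_ f →
  (∀ i j → adj G (f i) (f j) ≡ false) → IsInducedSubgraph (edgeless m) G
independent⇒induced-edgeless _ f f-injective independent =
  f , (λ _ _ → f-injective) , (λ i j → sym (independent i j))

module Threshold (m : ℕ) where

  c N : ℕ
  c = suc m
  N = c + c

  V : Set
  V = Fin (suc N)

  _~_ : Rel V 0ℓ
  s ~ t = s ≢ t × toℕ s + toℕ t ≤ suc N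

  _~?_ : Decidable _~_
  s ~? t = ¬? (s ≟ t) ×-dec (toℕ s + toℕ t ≤? suc N)

  ~-sym : Symmetric _~_
  ~-sym {s} {t} (s≢t , bound) = s≢t ∘ sym , subst (_≤ suc N) (+-comm (toℕ s) (toℕ t)) bound

  ~-irrefl : Irreflexive _≡_ _~_
  ~-irrefl s≡t (s≢t , _) = s≢t s≡t

  open FromRelation _~?_ ~-sym ~-irrefl

  G : Graph (suc N)
  G = graph

  H : Graph c
  H = edgeless c

  ≤1⇒~ : ∀ {s t : V} → toℕ s ≤ 1 → s ≢ t → s ~ t
  ≤1⇒~ {t = t} s≤1 s≢t = s≢t , +-mono-≤ s≤1 (toℕ≤pred[n] t)

  zero-universal : Universal G zero
  zero-universal u u≢0 = R⇒Adj (~-sym (≤1⇒~ z≤n (u≢0 ∘ sym)))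

  module _ {d} {j : Fin N} (d+j≡N : d + toℕ j ≡ N) where

    d≤N : d ≤ N
    d≤N = subst (d ≤_) d+j≡N (m≤m+n d (toℕ j))

    neighbourhood : Adj G (suc j) ≐ (λ u → toℕ u < suc d × u ≢ suc j)
    neighbourhood = (λ adjacent → let (j≢u , bound) = Adj⇒R adjacent in
                                  s≤s (bounded⇒≤d bound) , j≢u ∘ sym) ,
                    (λ (u≤d , u≢j) → R⇒Adj ((u≢j ∘ sym) , s≤s (≤d⇒bounded (s≤s⁻¹ u≤d))))
      where
      open ≤-Reasoning
      bounded⇒≤d : ∀ {u} → suc (toℕ j + u) ≤ suc N → u ≤ d
      bounded⇒≤d {u} bound = +-cancelʳ-≤ (toℕ j) u d (begin
        u + toℕ j  ≡⟨ +-comm u (toℕ j) ⟩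
        toℕ j + u  ≤⟨ s≤s⁻¹ bound ⟩
        N          ≡⟨ d+j≡N ⟨
        d + toℕ j  ∎)
      ≤d⇒bounded : ∀ {u} → u ≤ d → toℕ j + u ≤ N
      ≤d⇒bounded {u} u≤d = begin
        toℕ j + u  ≡⟨ +-comm (toℕ j) u ⟩
        u + toℕ j  ≤⟨ +-monoˡ-≤ (toℕ j) u≤d ⟩
        d + toℕ j  ≡⟨ d+j≡N ⟩
        N          ∎

    IsKappa-to-zero-<c : toℕ j < c → IsKappa G (suc j) zero (fin d)
    IsKappa-to-zero-<c j<c = IsKappa-universal zero-universal (λ ())
      (Enumeration-resp-≐ (swap neighbourhood)
        (remove-enumeration (prefix-enumeration (s≤s d≤N)) (s≤s j<d)))
      where
      j<d : toℕ j < d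
      j<d = +-cancelʳ-< (toℕ j) (toℕ j) d
              (subst (toℕ j + toℕ j <_) (sym d+j≡N) (+-mono-< j<c j<c))

    IsKappa-to-zero-≥c : c ≤ toℕ j → IsKappa G (suc j) zero (fin (suc d))
    IsKappa-to-zero-≥c c≤j = IsKappa-universal zero-universal (λ ())
      (Enumeration-resp-≐ (prefix⊆neighbourhood , proj₁ ∘ proj₁ neighbourhood)
        (prefix-enumeration (s≤s d≤N)))
      where
      d≤j : d ≤ toℕ j
      d≤j = +-cancelʳ-≤ (toℕ j) d (toℕ j)
              (subst (_≤ toℕ j + toℕ j) (sym d+j≡N) (+-mono-≤ c≤j c≤j))
      prefix⊆neighbourhood : ∀ {u} → toℕ u < suc d → Adj G (suc j) u
      prefix⊆neighbourhood u≤d = proj₂ neighbourhood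
        (u≤d , λ { refl → <⇒≱ u≤d (s≤s d≤j) })

  ĉ : Fin N
  ĉ = fromℕ< (m<m+n c z<s)

  toℕ-ĉ : toℕ ĉ ≡ c
  toℕ-ĉ = toℕ-fromℕ< (m<m+n c z<s)

  toℕ-inject₁-ĉ : toℕ (inject₁ ĉ) ≡ c
  toℕ-inject₁-ĉ = trans (toℕ-inject₁ ĉ) toℕ-ĉ

  c≤inject₁-ĉ : c ≤ toℕ (inject₁ ĉ)
  c≤inject₁-ĉ = ≤-reflexive (sym toℕ-inject₁-ĉ)

  inject₁-ĉ≢suc-ĉ : inject₁ ĉ ≢ suc ĉ
  inject₁-ĉ≢suc-ĉ eq =
    1+n≢n (trans (sym (cong suc toℕ-ĉ)) (trans (cong toℕ (sym eq)) toℕ-inject₁-ĉ))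

  c≤1+ĉ : c ≤ toℕ (suc ĉ)
  c≤1+ĉ = ≤-trans (≤-reflexive (sym toℕ-ĉ)) (n≤1+n (toℕ ĉ))

  N∸j+j≡N : ∀ (j : Fin N) → N ∸ toℕ j + toℕ j ≡ N
  N∸j+j≡N j = m∸n+n≡m (<⇒≤ (toℕ<n j))

  -- x is the degree of the vertex t + 1
  IsDegree : ℕ → ℕ → Set
  IsDegree t x = (t < c × x + t ≡ N) ⊎ (c < t × x + t ≡ suc N)

  degrees-do-not-straddle : ∀ {t₁ t₂ x} → t₁ < c → c < t₂ → x + t₁ ≡ N → x + t₂ ≡ suc N → ⊥
  degrees-do-not-straddle {t₁} {t₂} {x} t₁<c c<t₂ e₁ e₂ =
    <⇒≱ t₁<c (s≤s⁻¹ (subst (c <_) t₂≡1+t₁ c<t₂))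
    where
    t₂≡1+t₁ : t₂ ≡ suc t₁
    t₂≡1+t₁ = +-cancelˡ-≡ x t₂ (suc t₁) (trans e₂ (trans (cong suc (sym e₁)) (sym (+-suc x t₁))))

  IsDegree-injective : ∀ {t₁ t₂ x} → IsDegree t₁ x → IsDegree t₂ x → t₁ ≡ t₂
  IsDegree-injective (inj₁ (_ , e₁)) (inj₁ (_ , e₂)) = +-cancelˡ-≡ _ _ _ (trans e₁ (sym e₂))
  IsDegree-injective (inj₂ (_ , e₁)) (inj₂ (_ , e₂)) = +-cancelˡ-≡ _ _ _ (trans e₁ (sym e₂))
  IsDegree-injective (inj₁ (t₁<c , e₁)) (inj₂ (c<t₂ , e₂)) =
    ⊥-elim (degrees-do-not-straddle t₁<c c<t₂ e₁ e₂)
  IsDegree-injective (inj₂ (c<t₁ , e₁)) (inj₁ (t₂<c , e₂)) =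
    ⊥-elim (degrees-do-not-straddle t₂<c c<t₁ e₂ e₁)

  IsKappa-to-zero : ∀ (j : Fin N) → toℕ j ≢ c →
                    Σ ℕ λ x → IsKappa G (suc j) zero (fin x) × IsDegree (toℕ j) x
  IsKappa-to-zero j j≢c with <-cmp (toℕ j) c
  ... | tri< j<c _ _ =
    N ∸ toℕ j , IsKappa-to-zero-<c (N∸j+j≡N j) j<c , inj₁ (j<c , N∸j+j≡N j)
  ... | tri≈ _ j≡c _ = contradiction j≡c j≢c
  ... | tri> _ _ c<j =
    suc (N ∸ toℕ j) , IsKappa-to-zero-≥c (N∸j+j≡N j) (<⇒≤ c<j) , inj₂ (c<j , cong suc (N∸j+j≡N j))

  -- W = {0, c + 1}
  W : Subset (suc N)
  W = true Vec.∷ ⁅ ĉ ⁆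

  W-resolving : Resolving G W
  W-resolving = Resolving-outside outside
    where
    off-ĉ : ∀ {j} → suc j ∉ W → toℕ j ≢ c
    off-ĉ {j} j∉W j≡c = j∉W (Vec.there (subst (_∈ ⁅ ĉ ⁆) ĉ≡j (x∈⁅x⁆ ĉ)))
      where
      ĉ≡j : ĉ ≡ j
      ĉ≡j = toℕ-injective (trans toℕ-ĉ (sym j≡c))
    outside : ∀ {v₁ v₂} → v₁ ∉ W → v₂ ∉ W → SameRep G W v₁ v₂ → v₁ ≡ v₂
    outside {zero}            0∉W _   _ = contradiction Vec.here 0∉W
    outside {suc _}  {zero}   _   0∉W _ = contradiction Vec.here 0∉W
    outside {suc j₁} {suc j₂} j₁∉W j₂∉W same
      with IsKappa-to-zero j₁ (off-ĉ j₁∉W) | IsKappa-to-zero j₂ (off-ĉ j₂∉W)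
    ... | x , κ₁ , deg₁ | y , κ₂ , deg₂ =
      cong suc (toℕ-injective (IsDegree-injective deg₁ (subst (IsDegree _) (sym x≡y) deg₂)))
      where
      x≡y : x ≡ y
      x≡y = fin-injective (IsKappa-functional (proj₁ (same zero Vec.here (fin x)) κ₁) κ₂)

  low-twins : Twins G zero (suc zero)
  low-twins = R-twins⇒Twins λ z z≢0 z≢1 →
    mk⇔ (λ _ → ≤1⇒~ (s≤s z≤n) (z≢1 ∘ sym)) (λ _ → ≤1⇒~ z≤n (z≢0 ∘ sym))

  middle-twins : ∀ {x y : V} → toℕ x ≡ c → toℕ y ≡ suc c → Twins G x y
  middle-twins {x} {y} x≡c y≡1+c = R-twins⇒Twins λ z z≢x z≢y → mk⇔ (raise z≢y) (lower z≢x)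
    where
    raise : ∀ {z} → z ≢ y → x ~ z → y ~ z
    raise {z} z≢y (_ , bound) rewrite x≡c | y≡1+c = (z≢y ∘ sym) , s≤s (+-monoʳ-≤ c z≤c)
      where
      z≤1+c : toℕ z ≤ suc c
      z≤1+c = +-cancelˡ-≤ c _ _ (subst (c + toℕ z ≤_) (sym (+-suc c c)) bound)
      z≤c : toℕ z ≤ c
      z≤c = s≤s⁻¹ (≤∧≢⇒< z≤1+c (z≢y ∘ toℕ-injective ∘ λ z≡1+c → trans z≡1+c (sym y≡1+c)))
    lower : ∀ {z} → z ≢ x → y ~ z → x ~ z
    lower z≢x (_ , bound) rewrite x≡c | y≡1+c = (z≢x ∘ sym) , ≤-trans (n≤1+n _) bound

  low≢high : 1 ≤ m → ∀ {z₁ z₂ : V} → toℕ z₁ ≤ 1 → c ≤ toℕ z₂ → z₁ ≢ z₂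
  low≢high 1≤m z₁≤1 c≤z₂ refl = <⇒≱ (s≤s 1≤m) (≤-trans c≤z₂ z₁≤1)

  resolving⇒2≤∣W∣ : 1 ≤ m → ∀ W′ → Resolving G W′ → 2 ≤ ∣ W′ ∣
  resolving⇒2≤∣W∣ 1≤m W′ resolving
    with twins-meet-resolving (λ ()) low-twins resolving
       | twins-meet-resolving inject₁-ĉ≢suc-ĉ
           (middle-twins toℕ-inject₁-ĉ (cong suc toℕ-ĉ)) resolving
  ... | inj₁ 0∈W′ | inj₁ c∈W′   = x∈p∧y∈p∧x≢y⇒2≤∣p∣ 0∈W′ c∈W′   (low≢high 1≤m z≤n c≤inject₁-ĉ)
  ... | inj₁ 0∈W′ | inj₂ 1+c∈W′ = x∈p∧y∈p∧x≢y⇒2≤∣p∣ 0∈W′ 1+c∈W′ (low≢high 1≤m z≤n c≤1+ĉ)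
  ... | inj₂ 1∈W′ | inj₁ c∈W′   = x∈p∧y∈p∧x≢y⇒2≤∣p∣ 1∈W′ c∈W′   (low≢high 1≤m ≤-refl c≤inject₁-ĉ)
  ... | inj₂ 1∈W′ | inj₂ 1+c∈W′ = x∈p∧y∈p∧x≢y⇒2≤∣p∣ 1∈W′ 1+c∈W′ (low≢high 1≤m ≤-refl c≤1+ĉ)

  IsCdim-G : 1 ≤ m → IsCdim G 2
  IsCdim-G 1≤m = (W , W-resolving , cong suc (∣⁅x⁆∣≡1 ĉ)) , resolving⇒2≤∣W∣ 1≤m

  upper-block-sum : ∀ (i j : Fin c) → suc N < toℕ (suc c ↑ʳ i) + toℕ (suc c ↑ʳ j)
  upper-block-sum i j = begin-strict
    suc N                                <⟨ n<1+n (suc N) ⟩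
    suc (suc N)                          ≡⟨ cong suc (+-suc c c) ⟨
    suc c + suc c                        ≤⟨ +-mono-≤ (m≤m+n (suc c) _) (m≤m+n (suc c) _) ⟩
    (suc c + toℕ i) + (suc c + toℕ j)    ≡⟨ cong₂ _+_ (toℕ-↑ʳ (suc c) i) (toℕ-↑ʳ (suc c) j) ⟨
    toℕ (suc c ↑ʳ i) + toℕ (suc c ↑ʳ j)  ∎
    where open ≤-Reasoning

  upper-block-independent : ∀ (i j : Fin c) → adj G (suc c ↑ʳ i) (suc c ↑ʳ j) ≡ false
  upper-block-independent i j =
    ¬R⇒nonadjacent {suc c ↑ʳ i} {suc c ↑ʳ j} λ (_ , bound) → <⇒≱ (upper-block-sum i j) bound

  H-induced : IsInducedSubgraph H G
  H-induced =
    independent⇒induced-edgeless G (suc c ↑ʳ_) (↑ʳ-injective (suc c) _ _) upper-block-independent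

archimedean : ∀ (ε : ℚ) → 0ℚ <ℚ ε → ∀ k → Σ ℕ λ m → k ≤ m × (+ k) / 1 ≤ℚ ε * ((+ m) / 1)
archimedean ε@(mkℚ +[1+ a ] d-1 _) _ k = k ℕ.* D , m≤m*n k D ,
  -- ε ≥ 1 / D for the denominator D of ε
  toℚᵘ-cancel-≤ (let open ℚᵘ.≤-Reasoning in begin
  toℚᵘ ((+ k) / 1)                            ≃⟨ toℚᵘ-fromℚᵘ (mkℚᵘ (+ k) 0) ⟩
  mkℚᵘ (+ k) 0                                ≤⟨ *≤* k≤εkD ⟩
  mkℚᵘ +[1+ a ] d-1 ℚᵘ.* mkℚᵘ (+ (k ℕ.* D)) 0  ≃⟨ ℚᵘ.*-congˡ {toℚᵘ ε} (toℚᵘ-fromℚᵘ _) ⟨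
  toℚᵘ ε ℚᵘ.* toℚᵘ ((+ (k ℕ.* D)) / 1)        ≃⟨ toℚᵘ-homo-* ε ((+ (k ℕ.* D)) / 1) ⟨
  toℚᵘ (ε * ((+ (k ℕ.* D)) / 1))              ∎)
  where
  D : ℕ
  D = suc d-1
  k≤εkD : + k ℤ.* + (D ℕ.* 1) ℤ.≤ +[1+ a ] ℤ.* + (k ℕ.* D) ℤ.* + 1
  k≤εkD = begin
    + k ℤ.* + (D ℕ.* 1)              ≡⟨ ℤ.pos-* k (D ℕ.* 1) ⟨
    + (k ℕ.* (D ℕ.* 1))              ≡⟨ cong (λ x → + (k ℕ.* x)) (*-identityʳ D) ⟩
    + (k ℕ.* D)                      ≤⟨ ℤ.+≤+ (m≤n*m (k ℕ.* D) (suc a)) ⟩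
    + (suc a ℕ.* (k ℕ.* D))          ≡⟨ ℤ.pos-* (suc a) (k ℕ.* D) ⟩
    +[1+ a ] ℤ.* + (k ℕ.* D)         ≡⟨ ℤ.*-identityʳ _ ⟨
    +[1+ a ] ℤ.* + (k ℕ.* D) ℤ.* + 1 ∎
    where open ℤ.≤-Reasoning
archimedean (mkℚ +0 _ _) (*<* (ℤ.+<+ ()))
archimedean (mkℚ -[1+ _ ] _ _) (*<* ())

corollary2p9 : (ε : ℚ) → 0ℚ <ℚ ε →
  Σ ℕ λ n → Σ ℕ λ m → Σ (Graph (suc n)) λ G → Σ (Graph (suc m)) λ H →
    IsInducedSubgraph H G × Σ ℕ λ dG → Σ ℕ λ dH →
      IsCdim G dG × IsCdim H dH × 0 < dH × ((+ dG) / 1) ≤ℚ ε * ((+ dH) / 1)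
corollary2p9 ε 0<ε with archimedean ε 0<ε 2
... | m , 2≤m , 2≤εm =
  N , m , G , H , H-induced , 2 , m , IsCdim-G 1≤m , IsCdim-edgeless m , 1≤m , 2≤εm
  where
  open Threshold m
  1≤m : 1 ≤ m
  1≤m = <⇒≤ 2≤m
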